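{- Let $w, z, z_1, z_2 \in \mathbb{Z}[\zeta_8]$ be odd. Then (i) $\gamma_2(w, z)\, \gamma_2(z, w) = \mathrm{m}(wz)$; (ii) $\gamma_2(w, z_1z_2) = \mathrm{m}(w)\, \gamma_2(w, z_1)\, \gamma_2(w, z_2)$.
   Context: Let $M := \mathbb{Q}(\zeta_8)$, $K := \mathbb{Q}(\sqrt 2)$, and let $\sigma, \tau$ be the automorphisms of $M$ with $\sigma(\zeta_8) = -\zeta_8$ and $\tau(\zeta_8) = \zeta_8^{ -1}$. An element is odd if it generates an ideal coprime to $2$. The quadratic residue symbol $\left(\frac{\cdot}{\cdot}\right)_{2,K}$ of $K$ is defined for an odd prime ideal $\mathfrak{p}$ of $\mathbb{Z}[\sqrt2]$ as $0$ if the numerator lies in $\mathfrak{p}$, $1$ if it is a nonzero square mod $\mathfrak{p}$, $-1$ otherwise, and extended multiplicatively to odd ideals and odd elements. For odd $w, z \in \mathbb{Z}[\zeta_8]$ define \[ \gamma_2(w, z) := \left(\frac{\sigma(wz)\sigma\tau(wz)}{w\tau(w)}\right)_{2, K}, \qquad \mathrm{m}(w) := \gamma_2(w, 1) = \left(\frac{\sigma(w)\sigma\tau(w)}{w\tau(w)}\right)_{2, K}. \] -}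

module Defs where

open import Data.Integer using (ℤ; +_; -_; _+_; _-_; _*_)
open import Data.List using (List; []; _∷_)
open import Data.Product using (Σ; ∃; _×_; _,_)
open import Data.Sum using (_⊎_)
open import Relation.Nullary using (¬_)
open import Relation.Binary.PropositionalEquality using (_≡_)

-- K = Q(√2): the ring Z[√2], element  re + im·√2

record ZK : Set where
  constructor mkK
  field
    re : ℤ
    im : ℤ

infixl 7 _*K_
infixl 6 _-K_

_*K_ : ZK → ZK → ZK
mkK a b *K mkK c d = mkK (a * c + + 2 * (b * d)) (a * d + b * c)

_-K_ : ZK → ZK → ZK
mkK a b -K mkK c d = mkK (a - c) (b - d)

0K 1K : ZK
0K = mkK (+ 0) (+ 0)
1K = mkK (+ 1) (+ 0)

_∣K_ : ZK → ZK → Set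
a ∣K b = ∃ λ c → b ≡ a *K c

UnitK : ZK → Set
UnitK u = ∃ λ v → u *K v ≡ 1K

-- prime elements of Z[√2] (a PID, so these generate exactly the
-- nonzero prime ideals)
PrimeK : ZK → Set
PrimeK p = (¬ p ≡ 0K) × (¬ UnitK p) ×
           (∀ x y → p ∣K (x *K y) → p ∣K x ⊎ p ∣K y)

prodK : List ZK → ZK
prodK []       = 1K
prodK (p ∷ ps) = p *K prodK ps

data QRPrime (a p : ZK) : ℤ → Set where
  qr-zero : p ∣K a → QRPrime a p (+ 0)
  qr-sq   : ¬ p ∣K a → (∃ λ x → p ∣K (a -K x *K x)) → QRPrime a p (+ 1)
  qr-nsq  : ¬ p ∣K a → ¬ (∃ λ x → p ∣K (a -K x *K x)) → QRPrime a p (- + 1)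

data QRList (a : ZK) : List ZK → ℤ → Set where
  qrl-nil  : QRList a [] (+ 1)
  qrl-cons : ∀ {p ps s t} → PrimeK p → QRPrime a p s → QRList a ps t →
             QRList a (p ∷ ps) (s * t)

QRSym : ZK → ZK → ℤ → Set
QRSym a b s = ∃ λ u → ∃ λ ps → UnitK u × (b ≡ u *K prodK ps) × QRList a ps s

-- M = Q(ζ₈): Z[ζ₈], element  c0 + c1 ζ + c2 ζ² + c3 ζ³,  ζ⁴ = -1

record ZM : Set where
  constructor mkM
  field
    c0 c1 c2 c3 : ℤ

infixl 7 _*M_
infixl 6 _+M_

_*M_ : ZM → ZM → ZM
mkM a0 a1 a2 a3 *M mkM b0 b1 b2 b3 =
  mkM (a0 * b0 - a1 * b3 - a2 * b2 - a3 * b1)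
      (a0 * b1 + a1 * b0 - a2 * b3 - a3 * b2)
      (a0 * b2 + a1 * b1 + a2 * b0 - a3 * b3)
      (a0 * b3 + a1 * b2 + a2 * b1 + a3 * b0)

_+M_ : ZM → ZM → ZM
mkM a0 a1 a2 a3 +M mkM b0 b1 b2 b3 = mkM (a0 + b0) (a1 + b1) (a2 + b2) (a3 + b3)

1M 2M : ZM
1M = mkM (+ 1) (+ 0) (+ 0) (+ 0)
2M = mkM (+ 2) (+ 0) (+ 0) (+ 0)

-- σ(ζ) = -ζ
σ : ZM → ZM
σ (mkM a0 a1 a2 a3) = mkM a0 (- a1) a2 (- a3)

-- τ(ζ) = ζ⁻¹ = -ζ³
τ : ZM → ZM
τ (mkM a0 a1 a2 a3) = mkM a0 (- a3) (- a2) (- a1)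

OddM : ZM → Set
OddM w = ∃ λ x → ∃ λ y → x *M w +M y *M 2M ≡ 1M

-- τ-fixed elements c0 + c1(ζ - ζ³) (c2 = 0, c3 = -c1) lie in Z[√2],
-- with √2 = ζ - ζ³; toK reads off that element.  It is only applied
-- to τ-fixed elements below.
toK : ZM → ZK
toK (mkM a0 a1 a2 a3) = mkK a0 a1

Gamma2 : ZM → ZM → ℤ → Set
Gamma2 w z s = QRSym (toK (σ (w *M z) *M σ (τ (w *M z)))) (toK (w *M τ w)) s

Mfun : ZM → ℤ → Set
Mfun w s = Gamma2 w 1M s

-- Write N(x) = x τ(x) for the relative norm from ℤ[ζ₈] to ℤ[√2]; since σ
-- and τ commute, γ₂(w, z) = (N(σ(wz)) / N(w)) and m(w) = (N(σ w) / N(w)),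
-- and both N and N ∘ σ are multiplicative.  The symbol (a / b) is well
-- defined because ℤ[√2] has unique factorisation, and it is multiplicative
-- in the denominator, which gives (i).  For odd b it is also multiplicative
-- in the numerator: at a prime p ∤ 2 this says that the non-squares form a
-- single coset of the squares U² in U = (ℤ[√2]/p)ˣ, for otherwise U², aU²
-- and bU² would be three disjoint halves of the finite group U.  With
-- b = m(w), s = (N(σ z₁) / N(w)) and t = (N(σ z₂) / N(w)), (ii) then reads
-- b s t = b (b s) (b t), true because b ∈ {0, ±1}.

module Submission where

open import Defs
open import Data.Integer using (ℤ; _*_)
open import Data.Product using (_×_)
open import Relation.Binary.PropositionalEquality using (_≡_)

open import Algebra.Bundles using (CommutativeRing)
open import Data.Bool using (if_then_else_)
open import Data.Empty using (⊥-elim)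
open import Data.Fin using (Fin; zero; suc)
import Data.Fin as Fin
open import Data.Fin.Patterns using (0F; 1F; 2F)
import Data.Fin.Properties as Fin
open import Data.Integer as ℤ using (+_; -_; _+_; _-_; ∣_∣)
open import Data.Integer.DivMod using (_/ℕ_; _%ℕ_; a≡a%ℕn+[a/ℕn]*n; n%ℕd<d)
open import Data.Integer.Divisibility.Signed as ℤ∣ using (divides; _∣?_)
import Data.Integer.Properties as ℤ
import Data.Integer.Tactic.RingSolver as ℤ-Solver
open import Data.List using (List; []; _∷_; _++_)
open import Data.List.Relation.Unary.All as All using (All)
open import Data.Maybe using (Maybe; just; nothing)
open import Data.Nat as ℕ using (ℕ; zero; suc)
open import Data.Nat.Divisibility as ℕ∣ using (divides)
open import Data.Nat.Induction using (<-wellFounded)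
open import Data.Nat.Primality using (euclidsLemma; prime[2])
import Data.Nat.Properties as ℕ
import Data.Nat.Tactic.RingSolver as ℕ-Solver
open import Data.Product using (Σ; ∃; ∃₂; _,_; proj₁; proj₂; uncurry)
open import Data.Sum as Sum using (_⊎_; inj₁; inj₂; [_,_]′)
open import Function using (_∘_; _⇔_; mk⇔; module Equivalence)
open import Induction.WellFounded using (Acc; acc)
open import Level using (0ℓ)
open import Relation.Binary.Bundles using (DecSetoid)
open import Relation.Binary.Definitions using (tri<; tri≈; tri>)
open import Relation.Binary.PropositionalEquality using (refl; sym; trans; cong; cong₂; subst; subst₂; isEquivalence; module ≡-Reasoning)
import Relation.Binary.Reasoning.Setoid as ≈-Reasoning
open import Relation.Nullary using (¬_; Dec; yes; no; does)
open import Relation.Nullary.Decidable using (map′; ¬?; _×-dec_; dec-true; dec-false; decidable-stable)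
open import Relation.Unary using (Pred)
import Relation.Unary as U
open import Tactic.RingSolver using (solve-∀)
open import Tactic.RingSolver.Core.AlmostCommutativeRing using (AlmostCommutativeRing; fromCommutativeRing)

-- Arithmetic of ℤ[√2]

infixl 6 _+K_

_+K_ : ZK → ZK → ZK
mkK a b +K mkK c d = mkK (a + c) (b + d)

-- x -K y is definitionally x +K negK y, the form read by the ring solver.
negK : ZK → ZK
negK (mkK a b) = mkK (- a) (- b)

fromℤ : ℤ → ZK
fromℤ n = mkK n (+ 0)

2K : ZK
2K = fromℤ (+ 2)

conjK : ZK → ZK
conjK (mkK a b) = mkK a (- b)

normK : ZK → ℤ
normK (mkK a b) = a * a - + 2 * (b * b)

+K-assoc : ∀ x y z → (x +K y) +K z ≡ x +K (y +K z)
+K-assoc (mkK a b) (mkK c d) (mkK e f) = cong₂ mkK (ℤ.+-assoc a c e) (ℤ.+-assoc b d f)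

+K-comm : ∀ x y → x +K y ≡ y +K x
+K-comm (mkK a b) (mkK c d) = cong₂ mkK (ℤ.+-comm a c) (ℤ.+-comm b d)

+K-identityˡ : ∀ x → 0K +K x ≡ x
+K-identityˡ (mkK a b) = cong₂ mkK (ℤ.+-identityˡ a) (ℤ.+-identityˡ b)

+K-inverseˡ : ∀ x → negK x +K x ≡ 0K
+K-inverseˡ (mkK a b) = cong₂ mkK (ℤ.+-inverseˡ a) (ℤ.+-inverseˡ b)

*K-comm : ∀ x y → x *K y ≡ y *K x
*K-comm (mkK a b) (mkK c d) = cong₂ mkK (ℤ-Solver.solve (a ∷ b ∷ c ∷ d ∷ [])) (ℤ-Solver.solve (a ∷ b ∷ c ∷ d ∷ []))

*K-identityˡ : ∀ x → 1K *K x ≡ x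
*K-identityˡ (mkK a b) = cong₂ mkK (ℤ-Solver.solve (a ∷ b ∷ [])) (ℤ-Solver.solve (a ∷ b ∷ []))

*K-assoc : ∀ x y z → (x *K y) *K z ≡ x *K (y *K z)
*K-assoc (mkK a b) (mkK c d) (mkK e f) = cong₂ mkK (re a b c d e f) (im a b c d e f)
  where
  re : ∀ a b c d e f →
       let re* x y u v = x * u + + 2 * (y * v) ; im* x y u v = x * v + y * u
       in  re* (re* a b c d) (im* a b c d) e f ≡ re* a b (re* c d e f) (im* c d e f)
  re = ℤ-Solver.solve-∀
  im : ∀ a b c d e f →
       let re* x y u v = x * u + + 2 * (y * v) ; im* x y u v = x * v + y * u
       in  im* (re* a b c d) (im* a b c d) e f ≡ im* a b (re* c d e f) (im* c d e f)
  im = ℤ-Solver.solve-∀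

*K-distribˡ-+K : ∀ x y z → x *K (y +K z) ≡ x *K y +K x *K z
*K-distribˡ-+K (mkK a b) (mkK c d) (mkK e f) = cong₂ mkK (re a b c d e f) (im a b c d e f)
  where
  re : ∀ a b c d e f → a * (c + e) + + 2 * (b * (d + f)) ≡ (a * c + + 2 * (b * d)) + (a * e + + 2 * (b * f))
  re = ℤ-Solver.solve-∀
  im : ∀ a b c d e f → a * (d + f) + b * (c + e) ≡ (a * d + b * c) + (a * f + b * e)
  im = ℤ-Solver.solve-∀

ZK-commutativeRing : CommutativeRing 0ℓ 0ℓ
ZK-commutativeRing = record
  { Carrier = ZK ; _≈_ = _≡_ ; _+_ = _+K_ ; _*_ = _*K_ ; -_ = negK ; 0# = 0K ; 1# = 1K
  ; isCommutativeRing = record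
    { isRing = record
      { +-isAbelianGroup = record
        { isGroup = record
          { isMonoid = record
            { isSemigroup = record
              { isMagma = record { isEquivalence = isEquivalence ; ∙-cong = cong₂ _+K_ }
              ; assoc = +K-assoc }
            ; identity = +K-identityˡ , λ x → trans (+K-comm x 0K) (+K-identityˡ x) }
          ; inverse = +K-inverseˡ , λ x → trans (+K-comm x (negK x)) (+K-inverseˡ x)
          ; ⁻¹-cong = cong negK }
        ; comm = +K-comm }
      ; *-cong = cong₂ _*K_
      ; *-assoc = *K-assoc
      ; *-identity = *K-identityˡ , λ x → trans (*K-comm x 1K) (*K-identityˡ x)
      ; distrib = *K-distribˡ-+K , λ x y z → trans (*K-comm (y +K z) x)
                    (trans (*K-distribˡ-+K x y z) (cong₂ _+K_ (*K-comm x y) (*K-comm x z))) }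
    ; *-comm = *K-comm } }

open CommutativeRing ZK-commutativeRing
  using (ring; *-commutativeSemigroup)
  renaming (+-identityʳ to +K-identityʳ; -‿inverseʳ to +K-inverseʳ; *-identityʳ to *K-identityʳ; zeroʳ to *K-zeroʳ)
open import Algebra.Properties.Ring ring
  using (-‿involutive; -‿distribʳ-*; x[y-z]≈xy-xz; ⁻¹-anti-homo‿-; x∙y⁻¹≈ε⇒x≈y)
open import Algebra.Properties.CommutativeSemigroup *-commutativeSemigroup
  using (interchange; x∙yz≈y∙xz; xy∙z≈xz∙y)

ZK-ring : AlmostCommutativeRing 0ℓ 0ℓ
ZK-ring = fromCommutativeRing ZK-commutativeRing is-0K
  where
  is-0K : ∀ x → Maybe (0K ≡ x)
  is-0K (mkK a b) with a ℤ.≟ + 0 | b ℤ.≟ + 0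
  ... | yes refl | yes refl = just refl
  ... | _        | _        = nothing

x-Kz≡[x-Ky]+K[y-Kz] : ∀ x y z → x +K negK z ≡ (x +K negK y) +K (y +K negK z)
x-Kz≡[x-Ky]+K[y-Kz] = solve-∀ ZK-ring

x-K[-Kx]≡2x : ∀ x → x +K negK (negK x) ≡ (1K +K 1K) *K x
x-K[-Kx]≡2x = solve-∀ ZK-ring

xy-Kuv≡x[y-Kv]+K[x-Ku]v : ∀ x y u v → x *K y +K negK (u *K v) ≡ x *K (y +K negK v) +K (x +K negK u) *K v
xy-Kuv≡x[y-Kv]+K[x-Ku]v = solve-∀ ZK-ring

x²-Ky²≡[x-Ky][x+Ky] : ∀ x y → x *K x +K negK (y *K y) ≡ (x +K negK y) *K (x +K negK (negK y))
x²-Ky²≡[x-Ky][x+Ky] = solve-∀ ZK-ring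

[-Kx]-K[-Ky]≡-K[x-Ky] : ∀ x y → negK x +K negK (negK y) ≡ negK (x +K negK y)
[-Kx]-K[-Ky]≡-K[x-Ky] = solve-∀ ZK-ring

x≡[x-Ky]+Ky : ∀ x y → x ≡ (x +K negK y) +K y
x≡[x-Ky]+Ky = solve-∀ ZK-ring

c*[1*1]≡c : ∀ c → c *K (1K *K 1K) ≡ c
c*[1*1]≡c = solve-∀ ZK-ring

c[yv][yv]≡[cyy][vv] : ∀ c y v → c *K ((y *K v) *K (y *K v)) ≡ (c *K (y *K y)) *K (v *K v)
c[yv][yv]≡[cyy][vv] = solve-∀ ZK-ring

a[axx]≡[ax][ax] : ∀ a x → a *K (a *K (x *K x)) ≡ (a *K x) *K (a *K x)
a[axx]≡[ax][ax] = solve-∀ ZK-ring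

v[pe∏]≡p[ve∏] : ∀ v p e r → v *K (p *K e *K r) ≡ p *K (v *K e *K r)
v[pe∏]≡p[ve∏] = solve-∀ ZK-ring

fromℤ-*K : ∀ n x → fromℤ n *K x ≡ mkK (n * ZK.re x) (n * ZK.im x)
fromℤ-*K n (mkK a b) = cong₂ mkK (re n a b) (im n a b)
  where re : ∀ n a b → n * a + + 2 * (+ 0 * b) ≡ n * a
        re = ℤ-Solver.solve-∀
        im : ∀ n a b → n * b + + 0 * a ≡ n * b
        im = ℤ-Solver.solve-∀

[r+qn]-Kr≡nq : ∀ r r′ q q′ n → mkK (r + q * n) (r′ + q′ * n) -K mkK r r′ ≡ fromℤ n *K mkK q q′
[r+qn]-Kr≡nq r r′ q q′ n = cong₂ mkK (re r q q′ n) (im r′ q q′ n)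
  where re : ∀ r q q′ n → r + q * n - r ≡ n * q + + 2 * (+ 0 * q′)
        re = ℤ-Solver.solve-∀
        im : ∀ r′ q q′ n → r′ + q′ * n - r′ ≡ n * q′ + + 0 * q
        im = ℤ-Solver.solve-∀

x*conjx≡normx : ∀ x → x *K conjK x ≡ fromℤ (normK x)
x*conjx≡normx (mkK a b) = cong₂ mkK (re a b) (im a b)
  where re : ∀ a b → a * a + + 2 * (b * - b) ≡ a * a - + 2 * (b * b)
        re = ℤ-Solver.solve-∀
        im : ∀ a b → a * - b + b * a ≡ + 0
        im = ℤ-Solver.solve-∀

normK-* : ∀ x y → normK (x *K y) ≡ normK x * normK y
normK-* (mkK a b) (mkK c d) = identity a b c d
  where identity : ∀ a b c d → let N x y = x * x - + 2 * (y * y)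
                               in  N (a * c + + 2 * (b * d)) (a * d + b * c) ≡ N a b * N c d
        identity = ℤ-Solver.solve-∀

-- Infinite descent: m = 2k, then n = 2j with k² = 2j² and k < m.
m²≡2n²⇒m≡0 : ∀ m n → m ℕ.* m ≡ 2 ℕ.* (n ℕ.* n) → m ≡ 0
m²≡2n²⇒m≡0 m n = descent m {n} (<-wellFounded m)
  where
  double² : ∀ k → k ℕ.* 2 ℕ.* (k ℕ.* 2) ≡ 2 ℕ.* (2 ℕ.* (k ℕ.* k))
  double² = ℕ-Solver.solve-∀

  halve : ∀ m n → m ℕ.* m ≡ 2 ℕ.* (n ℕ.* n) → ∃ λ k → m ≡ k ℕ.* 2 × n ℕ.* n ≡ 2 ℕ.* (k ℕ.* k)
  halve m n eq with euclidsLemma m m prime[2] (ℕ∣.divides (n ℕ.* n) (trans eq (ℕ.*-comm 2 (n ℕ.* n))))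
  ... | inj₁ (ℕ∣.divides k refl) = k , refl , ℕ.*-cancelˡ-≡ _ _ 2 (trans (sym eq) (double² k))
  ... | inj₂ (ℕ∣.divides k refl) = k , refl , ℕ.*-cancelˡ-≡ _ _ 2 (trans (sym eq) (double² k))

  half< : ∀ k {m} → suc m ≡ k ℕ.* 2 → k ℕ.< suc m
  half< (suc k) refl = ℕ.m<m*n (suc k) 2 (ℕ.s≤s (ℕ.s≤s ℕ.z≤n))

  descent : ∀ m {n} → Acc ℕ._<_ m → m ℕ.* m ≡ 2 ℕ.* (n ℕ.* n) → m ≡ 0
  descent zero _ _ = refl
  descent (suc m) {n} (acc rec) eq with halve (suc m) n eq
  ... | k , m≡2k , n²≡2k² with halve n k n²≡2k²
  ...   | j , _ , k²≡2j² =
    trans m≡2k (cong (ℕ._* 2) (descent k {j} (rec (half< k m≡2k)) k²≡2j²))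

normK≡0⇒≡0K : ∀ x → normK x ≡ + 0 → x ≡ 0K
normK≡0⇒≡0K (mkK a b) eq = cong₂ mkK a≡0 b≡0
  where
  a²≡2b² : a * a ≡ + 2 * (b * b)
  a²≡2b² = ℤ.i-j≡0⇒i≡j _ _ eq
  a≡0 : a ≡ + 0
  a≡0 = ℤ.∣i∣≡0⇒i≡0 (m²≡2n²⇒m≡0 ∣ a ∣ ∣ b ∣ (begin
    ∣ a ∣ ℕ.* ∣ a ∣          ≡⟨ ℤ.abs-* a a ⟨
    ∣ a * a ∣                ≡⟨ cong ∣_∣ a²≡2b² ⟩
    ∣ + 2 * (b * b) ∣        ≡⟨ ℤ.abs-* (+ 2) (b * b) ⟩
    2 ℕ.* ∣ b * b ∣          ≡⟨ cong (2 ℕ.*_) (ℤ.abs-* b b) ⟩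
    2 ℕ.* (∣ b ∣ ℕ.* ∣ b ∣)  ∎))
    where open ≡-Reasoning
  b≡0 : b ≡ + 0
  b≡0 = [ (λ ()) , Sum.reduce ∘ ℤ.i*j≡0⇒i≡0∨j≡0 b ]′
          (ℤ.i*j≡0⇒i≡0∨j≡0 (+ 2) (trans (sym a²≡2b²) (cong (λ t → t * t) a≡0)))

*K-noZeroDivisors : ∀ x y → x *K y ≡ 0K → x ≡ 0K ⊎ y ≡ 0K
*K-noZeroDivisors x y eq = Sum.map (normK≡0⇒≡0K x) (normK≡0⇒≡0K y)
  (ℤ.i*j≡0⇒i≡0∨j≡0 (normK x) (trans (sym (normK-* x y)) (cong normK eq)))

*K-cancelˡ : ∀ {p} x y → ¬ p ≡ 0K → p *K x ≡ p *K y → x ≡ y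
*K-cancelˡ {p} x y p≢0 eq = [ ⊥-elim ∘ p≢0 , x∙y⁻¹≈ε⇒x≈y x y ]′ (*K-noZeroDivisors p (x -K y)
  (trans (x[y-z]≈xy-xz p x y) (trans (cong (_-K p *K y) eq) (+K-inverseʳ (p *K y)))))

∣K-trans : ∀ {x y z} → x ∣K y → y ∣K z → x ∣K z
∣K-trans {x} (c , refl) (d , refl) = c *K d , *K-assoc x c d

∣K-*ʳ : ∀ {x y} z → x ∣K y → x ∣K (y *K z)
∣K-*ʳ {x} z (c , refl) = c *K z , *K-assoc x c z

∣K-*ˡ : ∀ {x y} z → x ∣K y → x ∣K (z *K y)
∣K-*ˡ {x} {y} z x∣y = subst (x ∣K_) (*K-comm y z) (∣K-*ʳ {x} {y} z x∣y)

∣K-0 : ∀ x → x ∣K 0K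
∣K-0 x = 0K , sym (*K-zeroʳ x)

∣K-+ : ∀ {x y z} → x ∣K y → x ∣K z → x ∣K (y +K z)
∣K-+ {x} (c , refl) (d , refl) = c +K d , sym (*K-distribˡ-+K x c d)

∣K-neg : ∀ {x y} → x ∣K y → x ∣K negK y
∣K-neg {x} (c , refl) = negK c , -‿distribʳ-* x c

UnitK-* : ∀ {u v} → UnitK u → UnitK v → UnitK (u *K v)
UnitK-* {u} {v} (u' , uu'≡1) (v' , vv'≡1) = u' *K v' , trans (interchange u v u' v') (cong₂ _*K_ uu'≡1 vv'≡1)

∣K-UnitK : ∀ {x u} → x ∣K u → UnitK u → UnitK x
∣K-UnitK {x} (c , refl) (v , xcv≡1) = c *K v , trans (sym (*K-assoc x c v)) xcv≡1

PrimeK⇒≢0 : ∀ {p} → PrimeK p → ¬ p ≡ 0K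
PrimeK⇒≢0 (p≢0 , _ , _) = p≢0

PrimeK⇒¬UnitK : ∀ {p} → PrimeK p → ¬ UnitK p
PrimeK⇒¬UnitK (_ , p-nonunit , _) = p-nonunit

PrimeK-∣-* : ∀ {p} → PrimeK p → ∀ x y → p ∣K (x *K y) → p ∣K x ⊎ p ∣K y
PrimeK-∣-* (_ , _ , euclid) = euclid

PrimeK⇒∤1 : ∀ {p} → PrimeK p → ¬ p ∣K 1K
PrimeK⇒∤1 {p} p-prime p∣1 = PrimeK⇒¬UnitK p-prime (∣K-UnitK {p} {1K} p∣1 (1K , refl))

PrimeK-∤-* : ∀ {p x y} → PrimeK p → ¬ p ∣K x → ¬ p ∣K y → ¬ p ∣K (x *K y)
PrimeK-∤-* {x = x} {y} p-prime p∤x p∤y p∣xy = [ p∤x , p∤y ]′ (PrimeK-∣-* p-prime x y p∣xy)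

-- With q = p e: q divides p or e, and q ∣ e would make p a unit.
PrimeK-∣⇒∣ : ∀ {p q} → PrimeK p → PrimeK q → p ∣K q → q ∣K p
PrimeK-∣⇒∣ {p} {q} p-prime q-prime (e , q≡pe) =
  [ (λ q∣p → q∣p) , ⊥-elim ∘ PrimeK⇒¬UnitK p-prime ∘ q∣e⇒p-unit ]′
  (PrimeK-∣-* q-prime p e (1K , trans (sym q≡pe) (sym (*K-identityʳ q))))
  where
  open ≡-Reasoning
  q∣e⇒p-unit : q ∣K e → UnitK p
  q∣e⇒p-unit (f , e≡qf) = f , sym (*K-cancelˡ 1K (p *K f) (PrimeK⇒≢0 q-prime) (begin
    q *K 1K         ≡⟨ *K-identityʳ q ⟩
    q               ≡⟨ q≡pe ⟩
    p *K e          ≡⟨ cong (p *K_) e≡qf ⟩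
    p *K (q *K f)   ≡⟨ x∙yz≈y∙xz p q f ⟩
    q *K (p *K f)   ∎))

fromℤ-∣K⇔ : ∀ n x → fromℤ n ∣K x ⇔ (n ℤ∣.∣ ZK.re x × n ℤ∣.∣ ZK.im x)
fromℤ-∣K⇔ n (mkK a b) = mk⇔
  (λ { (c , eq) → let e = trans eq (fromℤ-*K n c) in
         divides (ZK.re c) (trans (cong ZK.re e) (ℤ.*-comm n _)) ,
         divides (ZK.im c) (trans (cong ZK.im e) (ℤ.*-comm n _)) })
  (λ { (divides q a≡qn , divides r b≡rn) →
         mkK q r , trans (cong₂ mkK (trans a≡qn (ℤ.*-comm q n)) (trans b≡rn (ℤ.*-comm r n)))
                         (sym (fromℤ-*K n (mkK q r))) })

-- Multiplying by the conjugate turns divisibility by p into divisibility by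
-- the rational integer N(p), which is decidable componentwise.
∣K⇔normK∣K : ∀ {p} x → ¬ p ≡ 0K → p ∣K x ⇔ fromℤ (normK p) ∣K (x *K conjK p)
∣K⇔normK∣K {p} x p≢0 = mk⇔
  (λ { (c , refl) → c , (begin
      p *K c *K conjK p      ≡⟨ xy∙z≈xz∙y p c (conjK p) ⟩
      p *K conjK p *K c      ≡⟨ cong (_*K c) (x*conjx≡normx p) ⟩
      fromℤ (normK p) *K c   ∎) })
  (λ { (c , eq) → c , *K-cancelˡ x (p *K c) conj≢0 (begin
      conjK p *K x           ≡⟨ *K-comm (conjK p) x ⟩
      x *K conjK p           ≡⟨ eq ⟩
      fromℤ (normK p) *K c   ≡⟨ cong (_*K c) (x*conjx≡normx p) ⟨
      p *K conjK p *K c      ≡⟨ cong (_*K c) (*K-comm p (conjK p)) ⟩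
      conjK p *K p *K c      ≡⟨ *K-assoc (conjK p) p c ⟩
      conjK p *K (p *K c)    ∎) })
  where
  open ≡-Reasoning
  conj≢0 : ¬ conjK p ≡ 0K
  conj≢0 conj≡0 = p≢0 (normK≡0⇒≡0K p (cong ZK.re (begin
    fromℤ (normK p)   ≡⟨ x*conjx≡normx p ⟨
    p *K conjK p      ≡⟨ cong (p *K_) conj≡0 ⟩
    p *K 0K           ≡⟨ *K-zeroʳ p ⟩
    0K                ∎)))

∣K-dec : ∀ {p} → ¬ p ≡ 0K → ∀ x → Dec (p ∣K x)
∣K-dec {p} p≢0 x = map′ (from₁ ∘ from₂) (to₂ ∘ to₁)
  (normK p ∣? ZK.re (x *K conjK p) ×-dec normK p ∣? ZK.im (x *K conjK p))
  where
  open Equivalence (∣K⇔normK∣K x p≢0) renaming (to to to₁; from to from₁)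
  open Equivalence (fromℤ-∣K⇔ (normK p) (x *K conjK p)) renaming (to to to₂; from to from₂)

-- Counting in finite sets

Fin-injective⇒surjective : ∀ {n} (f : Fin n → Fin n) → (∀ {i j} → f i ≡ f j → i ≡ j) →
                           ∀ j → ∃ λ i → f i ≡ j
Fin-injective⇒surjective {suc n} f f-inj j with Fin.any? (λ i → f i Fin.≟ j)
... | yes hit = hit
... | no miss = ⊥-elim (ℕ.1+n≰n (Fin.injective⇒≤ {f = f∖j} f∖j-injective))
  where
  f∖j : Fin (suc n) → Fin n
  f∖j i = Fin.punchOut (λ j≡fi → miss (i , sym j≡fi))
  f∖j-injective : ∀ {i i′} → f∖j i ≡ f∖j i′ → i ≡ i′
  f∖j-injective eq = f-inj (Fin.punchOut-injective {i = j} _ _ eq)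

×-injective⇒*≤* : ∀ {k l n} (f : Fin k × Fin n → Fin l × Fin n) →
                  (∀ {x y} → f x ≡ f y → x ≡ y) → k ℕ.* n ℕ.≤ l ℕ.* n
×-injective⇒*≤* {k} {l} {n} f f-inj = Fin.injective⇒≤ {f = combine ∘ f ∘ Fin.remQuot n} (λ {i} {j} eq → begin
    i                                ≡⟨ Fin.combine-remQuot {k} n i ⟨
    combine (Fin.remQuot {k} n i)    ≡⟨ cong combine (f-inj (combine-injective eq)) ⟩
    combine (Fin.remQuot {k} n j)    ≡⟨ Fin.combine-remQuot {k} n j ⟩
    j                                ∎)
  where
  open ≡-Reasoning
  combine : ∀ {a} → Fin a × Fin n → Fin (a ℕ.* n)
  combine (i , j) = Fin.combine i j
  combine-injective : ∀ {a} {x y : Fin a × Fin n} → combine x ≡ combine y → x ≡ y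
  combine-injective {x = i , j} {k , l} eq = uncurry (cong₂ _,_) (Fin.combine-injective i j k l eq)

module Enumeration (S : DecSetoid 0ℓ 0ℓ) {P : Pred (DecSetoid.Carrier S) 0ℓ} (P? : U.Decidable P) where
  open DecSetoid S renaming (Carrier to A; refl to ≈-refl; sym to ≈-sym; trans to ≈-trans)

  record Listing : Set where
    field
      size           : ℕ
      elem           : Fin size → A
      elem-P         : ∀ i → P (elem i)
      elem-injective : ∀ {i j} → elem i ≈ elem j → i ≡ j

  Listed : Listing → A → Set
  Listed L x = ∃ λ i → Listing.elem L i ≈ x

  private
    emptyListing : Listing
    emptyListing = record { size = 0 ; elem = λ () ; elem-P = λ () ; elem-injective = λ {i} → ⊥-elim (Fin.¬Fin0 i) }

    extend : (x : A) → P x → (L : Listing) → ¬ Listed L x → Listing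
    extend x Px L x-new = record
      { size = suc size ; elem = elem′ ; elem-P = elem′-P ; elem-injective = elem′-injective }
      where
      open Listing L
      elem′ : Fin (suc size) → A
      elem′ zero    = x
      elem′ (suc i) = elem i
      elem′-P : ∀ i → P (elem′ i)
      elem′-P zero    = Px
      elem′-P (suc i) = elem-P i
      elem′-injective : ∀ {i j} → elem′ i ≈ elem′ j → i ≡ j
      elem′-injective {zero}  {zero}  _  = refl
      elem′-injective {zero}  {suc j} eq = ⊥-elim (x-new (j , ≈-sym eq))
      elem′-injective {suc i} {zero}  eq = ⊥-elim (x-new (i , eq))
      elem′-injective {suc i} {suc j} eq = cong suc (elem-injective eq)

  deduplicate : ∀ {k} (f : Fin k → A) → Σ Listing λ L → ∀ g → P (f g) → Listed L (f g)
  deduplicate {zero} f = emptyListing , λ ()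
  deduplicate {suc k} f with deduplicate (f ∘ suc)
  ... | L , lists-rest with P? (f zero)
  ...   | no ¬Pf = L , λ { zero Pf → ⊥-elim (¬Pf Pf) ; (suc g) → lists-rest g }
  ...   | yes Pf with Fin.any? (λ i → Listing.elem L i ≟ f zero)
  ...     | yes listed = L , λ { zero _ → listed ; (suc g) → lists-rest g }
  ...     | no new = extend (f zero) Pf L new ,
                     λ { zero _ → zero , ≈-refl ; (suc g) Pg → let i , ei≈fg = lists-rest g Pg in suc i , ei≈fg }

  record Enumeration : Set where
    field
      listing  : Listing
      complete : ∀ {x} → P x → Listed listing x
    open Listing listing public

  enumerate : (∀ {x y} → x ≈ y → P x → P y) →
              ∀ {k} (f : Fin k → A) → (∀ x → ∃ λ g → f g ≈ x) → Enumeration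
  enumerate P-resp f f-covers = record { listing = proj₁ dedup ; complete = complete }
    where
    dedup = deduplicate f
    complete : ∀ {x} → P x → Listed (proj₁ dedup) x
    complete {x} Px =
      let g , fg≈x = f-covers x
          i , eᵢ≈fg = proj₂ dedup g (P-resp (≈-sym fg≈x) Px)
      in  i , ≈-trans eᵢ≈fg fg≈x

  module Enumerated (E : Enumeration) where
    open Enumeration E public

    index : ∀ {x} → P x → Fin size
    index Px = proj₁ (complete Px)

    elem-index : ∀ {x} (Px : P x) → elem (index Px) ≈ x
    elem-index Px = proj₂ (complete Px)

    index-injective : ∀ {x y} (Px : P x) (Py : P y) → index Px ≡ index Py → x ≈ y
    index-injective Px Py eq = ≈-trans (≈-sym (elem-index Px)) (subst (λ i → elem i ≈ _) (sym eq) (elem-index Py))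

    index-cong : ∀ {x y} → x ≈ y → (Px : P x) (Py : P y) → index Px ≡ index Py
    index-cong x≈y Px Py = elem-injective (≈-trans (elem-index Px) (≈-trans x≈y (≈-sym (elem-index Py))))

    index-elem : ∀ i → index (elem-P i) ≡ i
    index-elem i = elem-injective (elem-index (elem-P i))

    injective⇒surjective : (F : A → A) → (∀ {x} → P x → P (F x)) →
                           (∀ {x y} → P x → P y → F x ≈ F y → x ≈ y) →
                           ∀ {y} → P y → ∃ λ x → P x × F x ≈ y
    injective⇒surjective F F-P F-injective Py
      with Fin-injective⇒surjective F̂ F̂-injective (index Py)
      where
      F̂ : Fin size → Fin size
      F̂ i = index (F-P (elem-P i))
      F̂-injective : ∀ {i j} → F̂ i ≡ F̂ j → i ≡ j
      F̂-injective eq = elem-injective (F-injective (elem-P _) (elem-P _) (index-injective _ _ eq))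
    ... | i , F̂i≡y = elem i , elem-P i , index-injective _ Py F̂i≡y

-- Residues modulo a prime of ℤ[√2]

SquareMod : ZK → ZK → Set
SquareMod p a = ∃ λ x → p ∣K (a -K x *K x)

infix 4 _≈_modK_

record _≈_modK_ (x y p : ZK) : Set where
  constructor mk≈mod
  field ∣-diff : p ∣K (x -K y)
open _≈_modK_ public

module _ {p : ZK} where

  ≈mod-refl : ∀ {x} → x ≈ x modK p
  ≈mod-refl {x} = mk≈mod (subst (p ∣K_) (sym (+K-inverseʳ x)) (∣K-0 p))

  ≈mod-sym : ∀ {x y} → x ≈ y modK p → y ≈ x modK p
  ≈mod-sym {x} {y} (mk≈mod p∣x-y) = mk≈mod (subst (p ∣K_) (⁻¹-anti-homo‿- x y) (∣K-neg {p} p∣x-y))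

  ≈mod-trans : ∀ {x y z} → x ≈ y modK p → y ≈ z modK p → x ≈ z modK p
  ≈mod-trans {x} {y} {z} (mk≈mod p∣x-y) (mk≈mod p∣y-z) =
    mk≈mod (subst (p ∣K_) (sym (x-Kz≡[x-Ky]+K[y-Kz] x y z)) (∣K-+ {p} p∣x-y p∣y-z))

  ≡⇒≈mod : ∀ {x y} → x ≡ y → x ≈ y modK p
  ≡⇒≈mod refl = ≈mod-refl

  ≈mod-*-cong : ∀ {x y u v} → x ≈ u modK p → y ≈ v modK p → x *K y ≈ u *K v modK p
  ≈mod-*-cong {x} {y} {u} {v} (mk≈mod p∣x-u) (mk≈mod p∣y-v) = mk≈mod
    (subst (p ∣K_) (sym (xy-Kuv≡x[y-Kv]+K[x-Ku]v x y u v)) (∣K-+ {p} (∣K-*ˡ {p} x p∣y-v) (∣K-*ʳ {p} v p∣x-u)))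

  ≈mod-*ˡ : ∀ c {x y} → x ≈ y modK p → c *K x ≈ c *K y modK p
  ≈mod-*ˡ c = ≈mod-*-cong (≈mod-refl {c})

  ≈mod-negK-cong : ∀ {x y} → x ≈ y modK p → negK x ≈ negK y modK p
  ≈mod-negK-cong {x} {y} (mk≈mod p∣x-y) =
    mk≈mod (subst (p ∣K_) (sym ([-Kx]-K[-Ky]≡-K[x-Ky] x y)) (∣K-neg {p} p∣x-y))

  ∣K-resp-≈mod : ∀ {x y} → x ≈ y modK p → p ∣K y → p ∣K x
  ∣K-resp-≈mod {x} {y} (mk≈mod p∣x-y) p∣y = subst (p ∣K_) (sym (x≡[x-Ky]+Ky x y)) (∣K-+ {p} p∣x-y p∣y)

QRPrime-unique : ∀ {a p s t} → QRPrime a p s → QRPrime a p t → s ≡ t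
QRPrime-unique (qr-zero _)      (qr-zero _)      = refl
QRPrime-unique (qr-sq _ _)      (qr-sq _ _)      = refl
QRPrime-unique (qr-nsq _ _)     (qr-nsq _ _)     = refl
QRPrime-unique (qr-zero p∣a)    (qr-sq p∤a _)    = ⊥-elim (p∤a p∣a)
QRPrime-unique (qr-zero p∣a)    (qr-nsq p∤a _)   = ⊥-elim (p∤a p∣a)
QRPrime-unique (qr-sq p∤a _)    (qr-zero p∣a)    = ⊥-elim (p∤a p∣a)
QRPrime-unique (qr-nsq p∤a _)   (qr-zero p∣a)    = ⊥-elim (p∤a p∣a)
QRPrime-unique (qr-sq _ □a)     (qr-nsq _ ¬□a)   = ⊥-elim (¬□a □a)
QRPrime-unique (qr-nsq _ ¬□a)   (qr-sq _ □a)     = ⊥-elim (¬□a □a)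

module Residues {p : ZK} (p-prime : PrimeK p) where

  p≢0 : ¬ p ≡ 0K
  p≢0 = PrimeK⇒≢0 p-prime

  residues : DecSetoid 0ℓ 0ℓ
  residues = record
    { Carrier = ZK
    ; _≈_ = _≈_modK p
    ; isDecEquivalence = record
      { isEquivalence = record { refl = ≈mod-refl ; sym = ≈mod-sym ; trans = ≈mod-trans }
      ; _≟_ = λ x y → map′ mk≈mod ∣-diff (∣K-dec p≢0 (x -K y)) } }

  Unit : ZK → Set
  Unit x = ¬ p ∣K x

  Unit-1 : Unit 1K
  Unit-1 = PrimeK⇒∤1 p-prime

  Unit-* : ∀ {x y} → Unit x → Unit y → Unit (x *K y)
  Unit-* = PrimeK-∤-* p-prime

  Unit-negK : ∀ {x} → Unit x → Unit (negK x)
  Unit-negK {x} x-unit p∣-x = x-unit (subst (p ∣K_) (-‿involutive x) (∣K-neg {p} p∣-x))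

  Unit-resp : ∀ {x y} → x ≈ y modK p → Unit x → Unit y
  Unit-resp x≈y x-unit p∣y = x-unit (∣K-resp-≈mod x≈y p∣y)

  ≈mod-cancelˡ : ∀ {c x y} → Unit c → c *K x ≈ c *K y modK p → x ≈ y modK p
  ≈mod-cancelˡ {c} {x} {y} c-unit (mk≈mod p∣cx-cy) =
    [ ⊥-elim ∘ c-unit , mk≈mod ]′
      (PrimeK-∣-* p-prime c (x -K y) (subst (p ∣K_) (sym (x[y-z]≈xy-xz c x y)) p∣cx-cy))

  x²≈y²⇒x≈±y : ∀ {x y} → x *K x ≈ y *K y modK p → x ≈ y modK p ⊎ x ≈ negK y modK p
  x²≈y²⇒x≈±y {x} {y} (mk≈mod p∣x²-y²) =
    Sum.map mk≈mod mk≈mod (PrimeK-∣-* p-prime (x -K y) (x -K (negK y))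
      (subst (p ∣K_) (x²-Ky²≡[x-Ky][x+Ky] x y) p∣x²-y²))

  -- Residues are represented by the grid a + b√2 with 0 ≤ a, b < |N(p)|, since p ∣ N(p).
  n : ℕ
  n = ∣ normK p ∣

  instance
    n-nonZero : ℕ.NonZero n
    n-nonZero = ℕ.≢-nonZero (p≢0 ∘ normK≡0⇒≡0K p ∘ ℤ.∣i∣≡0⇒i≡0)

  p∣n : p ∣K fromℤ (+ n)
  p∣n = [ (λ n≡N → subst (λ t → p ∣K fromℤ t) (sym n≡N) p∣N)
        , (λ n≡-N → subst (λ t → p ∣K fromℤ t) (sym n≡-N) (∣K-neg {p} p∣N)) ]′
        (ℤ.+∣i∣≡i⊎+∣i∣≡-i (normK p))
    where p∣N : p ∣K fromℤ (normK p)
          p∣N = conjK p , sym (x*conjx≡normx p)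

  grid : Fin n × Fin n → ZK
  grid (i , j) = mkK (+ Fin.toℕ i) (+ Fin.toℕ j)

  grid-covers : ∀ x → ∃ λ g → grid g ≈ x modK p
  grid-covers (mkK a b) = (i , j) , ≈mod-sym (mk≈mod (subst (p ∣K_) (sym x-grid) (∣K-*ʳ {p} _ p∣n)))
    where
    i j : Fin n
    i = Fin.fromℕ< (n%ℕd<d a n)
    j = Fin.fromℕ< (n%ℕd<d b n)
    x-grid : mkK a b -K grid (i , j) ≡ fromℤ (+ n) *K mkK (a /ℕ n) (b /ℕ n)
    x-grid = begin
      mkK a b -K grid (i , j)
        ≡⟨ cong₂ (λ s t → mkK s t -K grid (i , j)) (a≡a%ℕn+[a/ℕn]*n a n) (a≡a%ℕn+[a/ℕn]*n b n) ⟩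
      mkK (+ (a %ℕ n) + (a /ℕ n) * + n) (+ (b %ℕ n) + (b /ℕ n) * + n) -K grid (i , j)
        ≡⟨ cong₂ (λ s t → mkK (+ (a %ℕ n) + (a /ℕ n) * + n) (+ (b %ℕ n) + (b /ℕ n) * + n) -K mkK (+ s) (+ t))
                 (Fin.toℕ-fromℕ< (n%ℕd<d a n)) (Fin.toℕ-fromℕ< (n%ℕd<d b n)) ⟩
      mkK (+ (a %ℕ n) + (a /ℕ n) * + n) (+ (b %ℕ n) + (b /ℕ n) * + n) -K mkK (+ (a %ℕ n)) (+ (b %ℕ n))
        ≡⟨ [r+qn]-Kr≡nq (+ (a %ℕ n)) (+ (b %ℕ n)) (a /ℕ n) (b /ℕ n) (+ n) ⟩
      fromℤ (+ n) *K mkK (a /ℕ n) (b /ℕ n) ∎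
      where open ≡-Reasoning

  open Enumeration residues (λ x → ¬? (∣K-dec p≢0 x)) using (Enumeration; enumerate; module Enumerated)

  opaque
    units : Enumeration
    units = enumerate Unit-resp (grid ∘ Fin.remQuot n) covers
      where covers : ∀ x → ∃ λ g → grid (Fin.remQuot n g) ≈ x modK p
            covers x = let (i , j) , g≈x = grid-covers x
                       in Fin.combine i j , subst (λ g → grid g ≈ x modK p) (sym (Fin.remQuot-combine i j)) g≈x

  open Enumerated units

  inverse : ∀ {u} → Unit u → ∃ λ v → u *K v ≈ 1K modK p
  inverse {u} u-unit =
    let v , _ , uv≈1 = injective⇒surjective (u *K_) (Unit-* u-unit) (λ _ _ → ≈mod-cancelˡ u-unit) Unit-1
    in v , uv≈1

  witness≈ : ∀ a x → p ∣K (a -K x *K x) → a ≈ x *K x modK p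
  witness≈ a x = mk≈mod

  squareMod-dec : ∀ a → Dec (SquareMod p a)
  squareMod-dec a = decide (∣K-dec p≢0 a)
    where
    listed : Unit a → SquareMod p a → ∃ λ i → a ≈ elem i *K elem i modK p
    listed a-unit (x , p∣a-x²) =
      index x-unit , ≈mod-trans a≈x² (≈mod-sym (≈mod-*-cong (elem-index x-unit) (elem-index x-unit)))
      where
      a≈x² = witness≈ a x p∣a-x²
      x-unit : Unit x
      x-unit p∣x = a-unit (∣K-resp-≈mod a≈x² (∣K-*ʳ {p} {x} x p∣x))
    decide : Dec (p ∣K a) → Dec (SquareMod p a)
    decide (yes p∣a)   = yes (0K , subst (p ∣K_) (sym (+K-identityʳ a)) p∣a)
    decide (no a-unit) = map′ (λ (i , a≈eᵢ²) → elem i , ∣-diff a≈eᵢ²) (listed a-unit)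
                              (Fin.any? λ i → DecSetoid._≟_ residues a (elem i *K elem i))

  squareMod-* : ∀ {x y} → SquareMod p x → SquareMod p y → SquareMod p (x *K y)
  squareMod-* {x} {y} (u , p∣x-u²) (v , p∣y-v²) = u *K v , ∣-diff
    (≈mod-trans (≈mod-*-cong (witness≈ x u p∣x-u²) (witness≈ y v p∣y-v²)) (≡⇒≈mod (interchange u u v v)))

  squareMod-ratio : ∀ {c y z} → Unit y → c *K (y *K y) ≈ z *K z modK p → SquareMod p c
  squareMod-ratio {c} {y} {z} y-unit cy²≈z² =
    let v , yv≈1 = inverse y-unit in
    z *K v , ∣-diff (begin
      c                                 ≡⟨ c*[1*1]≡c c ⟨
      c *K (1K *K 1K)                   ≈⟨ ≈mod-*ˡ c (≈mod-*-cong yv≈1 yv≈1) ⟨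
      c *K ((y *K v) *K (y *K v))       ≡⟨ c[yv][yv]≡[cyy][vv] c y v ⟩
      (c *K (y *K y)) *K (v *K v)       ≈⟨ ≈mod-*-cong cy²≈z² ≈mod-refl ⟩
      (z *K z) *K (v *K v)              ≡⟨ interchange z z v v ⟩
      (z *K v) *K (z *K v)              ∎)
    where open ≈-Reasoning (DecSetoid.setoid residues)

  squareMod-cancel : ∀ {x y} → Unit x → SquareMod p x → SquareMod p (x *K y) → SquareMod p y
  squareMod-cancel {x} {y} x-unit (u , p∣x-u²) (w , p∣xy-w²) = squareMod-ratio {y} {u} {w} u-unit
    (≈mod-trans (≈mod-*ˡ y (≈mod-sym x≈u²)) (≈mod-trans (≡⇒≈mod (*K-comm y x)) (witness≈ (x *K y) w p∣xy-w²)))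
    where
    x≈u² = witness≈ x u p∣x-u²
    u-unit : Unit u
    u-unit p∣u = x-unit (∣K-resp-≈mod x≈u² (∣K-*ʳ {p} {u} u p∣u))

  QRPrime-exists : ∀ a → ∃ λ s → QRPrime a p s
  QRPrime-exists a = decide (∣K-dec p≢0 a) (squareMod-dec a)
    where
    decide : Dec (p ∣K a) → Dec (SquareMod p a) → ∃ λ s → QRPrime a p s
    decide (yes p∣a) _      = + 0 , qr-zero p∣a
    decide (no p∤a) (yes □a) = + 1 , qr-sq p∤a □a
    decide (no p∤a) (no ¬□a) = - + 1 , qr-nsq p∤a ¬□a

  module Odd (p-odd : ¬ p ∣K 2K) where

    ≉negK : ∀ {x} → Unit x → ¬ x ≈ negK x modK p
    ≉negK {x} x-unit (mk≈mod p∣x+x) =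
      [ p-odd , x-unit ]′ (PrimeK-∣-* p-prime 2K x (subst (p ∣K_) (x-K[-Kx]≡2x x) p∣x+x))

    less : Fin size → Fin size → Fin 2
    less i j = if does (i Fin.<? j) then zero else suc zero

    less-asym : ∀ {i j} → ¬ i ≡ j → ¬ less i j ≡ less j i
    less-asym {i} {j} i≢j eq with Fin.<-cmp i j
    ... | tri< i<j _ j≮i rewrite dec-true (i Fin.<? j) i<j | dec-false (j Fin.<? i) j≮i = case eq
      where case : ¬ zero ≡ suc zero
            case ()
    ... | tri≈ _ i≡j _ = i≢j i≡j
    ... | tri> i≮j _ j<i rewrite dec-false (i Fin.<? j) i≮j | dec-true (j Fin.<? i) j<i = case eq
      where case : ¬ suc zero ≡ zero
            case ()

    -- Singles out one of each pair {x, -x} of listed units, as x ≉ -x for odd p.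
    sign : Fin size → Fin 2
    sign i = less i (index (Unit-negK (elem-P i)))

    sign-flips : ∀ {i j} → elem i ≈ negK (elem j) modK p → ¬ sign i ≡ sign j
    sign-flips {i} {j} eᵢ≈-eⱼ eq = less-asym i≢j
      (subst₂ (λ k l → less i k ≡ less j l) (antipode eᵢ≈-eⱼ) (antipode eⱼ≈-eᵢ) eq)
      where
      antipode : ∀ {k l} → elem k ≈ negK (elem l) modK p → index (Unit-negK (elem-P k)) ≡ l
      antipode {k} {l} eₖ≈-eₗ = trans (index-cong -eₖ≈eₗ _ (elem-P l)) (index-elem l)
        where -eₖ≈eₗ = ≈mod-trans (≈mod-negK-cong eₖ≈-eₗ) (≡⇒≈mod (-‿involutive (elem l)))
      eⱼ≈-eᵢ : elem j ≈ negK (elem i) modK p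
      eⱼ≈-eᵢ = ≈mod-trans (≈mod-sym (≡⇒≈mod (-‿involutive (elem j)))) (≈mod-negK-cong (≈mod-sym eᵢ≈-eⱼ))
      i≢j : ¬ i ≡ j
      i≢j refl = ≉negK (elem-P i) eᵢ≈-eⱼ

    -- If a, b and ab were all non-squares, the cosets U², aU², bU² would be
    -- disjoint, each with |U|/2 elements since x² = y² only for y = ±x.
    -- The injection (i, x) ↦ (sign x, cᵢ x²) makes this count precise.
    nonsquares-* : ∀ {a b} → Unit a → Unit b → ¬ SquareMod p a → ¬ SquareMod p b → ¬ ¬ SquareMod p (a *K b)
    nonsquares-* {a} {b} a-unit b-unit ¬□a ¬□b ¬□ab =
      ℕ.<⇒≱ (ℕ.*-monoˡ-< size (ℕ.n<1+n 2)) (×-injective⇒*≤* f f-injective)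
      where
      instance
        size-nonZero : ℕ.NonZero size
        size-nonZero = Fin.nonZeroIndex (index Unit-1)

      c : Fin 3 → ZK
      c 0F = 1K
      c 1F = a
      c 2F = b

      c-unit : ∀ i → Unit (c i)
      c-unit 0F = Unit-1
      c-unit 1F = a-unit
      c-unit 2F = b-unit

      ratio : ∀ {d x y} → 1K *K (x *K x) ≈ d *K (y *K y) modK p → Unit y → SquareMod p d
      ratio {d} {x} {y} x²≈dy² y-unit = squareMod-ratio {d} {y} {x} y-unit
        (≈mod-trans (≈mod-sym x²≈dy²) (≡⇒≈mod (*K-identityˡ (x *K x))))

      mixed : ∀ {x y} → a *K (x *K x) ≈ b *K (y *K y) modK p → Unit y → SquareMod p (a *K b)
      mixed {x} {y} ax²≈by² y-unit = squareMod-ratio {a *K b} {y} {a *K x} y-unit (begin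
        a *K b *K (y *K y)      ≡⟨ *K-assoc a b (y *K y) ⟩
        a *K (b *K (y *K y))    ≈⟨ ≈mod-*ˡ a ax²≈by² ⟨
        a *K (a *K (x *K x))    ≡⟨ a[axx]≡[ax][ax] a x ⟩
        (a *K x) *K (a *K x)    ∎)
        where open ≈-Reasoning (DecSetoid.setoid residues)

      separates : ∀ i j {x y} → c i *K (x *K x) ≈ c j *K (y *K y) modK p → Unit x → Unit y → i ≡ j
      separates 0F 0F _ _ _ = refl
      separates 1F 1F _ _ _ = refl
      separates 2F 2F _ _ _ = refl
      separates 0F 1F {x} {y} h _ y-unit = ⊥-elim (¬□a (ratio {a} {x} {y} h y-unit))
      separates 1F 0F {x} {y} h x-unit _ = ⊥-elim (¬□a (ratio {a} {y} {x} (≈mod-sym h) x-unit))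
      separates 0F 2F {x} {y} h _ y-unit = ⊥-elim (¬□b (ratio {b} {x} {y} h y-unit))
      separates 2F 0F {x} {y} h x-unit _ = ⊥-elim (¬□b (ratio {b} {y} {x} (≈mod-sym h) x-unit))
      separates 1F 2F {x} {y} h _ y-unit = ⊥-elim (¬□ab (mixed {x} {y} h y-unit))
      separates 2F 1F {x} {y} h x-unit _ = ⊥-elim (¬□ab (mixed {y} {x} (≈mod-sym h) x-unit))

      scaled-unit : ∀ i j → Unit (c i *K (elem j *K elem j))
      scaled-unit i j =
        Unit-* {c i} {elem j *K elem j} (c-unit i) (Unit-* {elem j} {elem j} (elem-P j) (elem-P j))

      f : Fin 3 × Fin size → Fin 2 × Fin size
      f (i , j) = sign j , index (scaled-unit i j)

      f-injective : ∀ {x y} → f x ≡ f y → x ≡ y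
      f-injective {i , j} {i′ , j′} eq =
        same-coset (separates i i′ {elem j} {elem j′} scaled≈ (elem-P j) (elem-P j′)) scaled≈
        where
        scaled≈ = index-injective (scaled-unit i j) (scaled-unit i′ j′) (cong proj₂ eq)
        same-coset : i ≡ i′ → c i *K (elem j *K elem j) ≈ c i′ *K (elem j′ *K elem j′) modK p →
                     (i , j) ≡ (i′ , j′)
        same-coset refl h =
          [ cong (i ,_) ∘ elem-injective , (λ eⱼ≈-eⱼ′ → ⊥-elim (sign-flips eⱼ≈-eⱼ′ (cong proj₁ eq))) ]′
          (x²≈y²⇒x≈±y (≈mod-cancelˡ {c i} (c-unit i) h))

    QRPrime-* : ∀ {x y s t} → QRPrime x p s → QRPrime y p t → QRPrime (x *K y) p (s * t)
    QRPrime-* {x} {y} (qr-zero p∣x)   _               = qr-zero (∣K-*ʳ {p} {x} y p∣x)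
    QRPrime-* {x} {y} (qr-sq _ _)     (qr-zero p∣y)   = qr-zero (∣K-*ˡ {p} {y} x p∣y)
    QRPrime-* {x} {y} (qr-nsq _ _)    (qr-zero p∣y)   = qr-zero (∣K-*ˡ {p} {y} x p∣y)
    QRPrime-* {x} {y} (qr-sq p∤x □x)  (qr-sq p∤y □y)  =
      qr-sq (Unit-* {x} {y} p∤x p∤y) (squareMod-* {x} {y} □x □y)
    QRPrime-* {x} {y} (qr-sq p∤x □x)  (qr-nsq p∤y ¬□y) =
      qr-nsq (Unit-* {x} {y} p∤x p∤y) (¬□y ∘ squareMod-cancel {x} {y} p∤x □x)
    QRPrime-* {x} {y} (qr-nsq p∤x ¬□x) (qr-sq p∤y □y) =
      qr-nsq (Unit-* {x} {y} p∤x p∤y) (¬□x ∘ squareMod-cancel {y} {x} p∤y □y ∘ subst (SquareMod p) (*K-comm x y))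
    QRPrime-* {x} {y} (qr-nsq p∤x ¬□x) (qr-nsq p∤y ¬□y) =
      qr-sq (Unit-* {x} {y} p∤x p∤y)
        (decidable-stable (squareMod-dec (x *K y)) (nonsquares-* {x} {y} p∤x p∤y ¬□x ¬□y))

-- The quadratic residue symbol of ℤ[√2]

prodK-++ : ∀ ps qs → prodK (ps ++ qs) ≡ prodK ps *K prodK qs
prodK-++ []       qs = sym (*K-identityˡ (prodK qs))
prodK-++ (p ∷ ps) qs = trans (cong (p *K_) (prodK-++ ps qs)) (sym (*K-assoc p (prodK ps) (prodK qs)))

prodK-middle : ∀ l q r → prodK (l ++ q ∷ r) ≡ q *K prodK (l ++ r)
prodK-middle []      q r = refl
prodK-middle (p ∷ l) q r = trans (cong (p *K_) (prodK-middle l q r)) (x∙yz≈y∙xz p q (prodK (l ++ r)))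

PrimeK-associate : ∀ {p q e} → PrimeK p → PrimeK q → q ≡ p *K e → UnitK e
PrimeK-associate {p} {q} {e} p-prime q-prime q≡pe =
  let f , p≡qf = PrimeK-∣⇒∣ p-prime q-prime (e , q≡pe) in
  f , *K-cancelˡ (e *K f) 1K (PrimeK⇒≢0 p-prime) (begin
    p *K (e *K f)   ≡⟨ *K-assoc p e f ⟨
    p *K e *K f     ≡⟨ cong (_*K f) q≡pe ⟨
    q *K f          ≡⟨ p≡qf ⟨
    p               ≡⟨ *K-identityʳ p ⟨
    p *K 1K         ∎)
  where open ≡-Reasoning

record Associate (p : ZK) (qs : List ZK) : Set where
  field
    before after : List ZK
    q e          : ZK
    qs≡          : qs ≡ before ++ q ∷ after
    q≡pe         : q ≡ p *K e
    e-unit       : UnitK e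

PrimeK-∣-prodK : ∀ {p qs} → PrimeK p → All PrimeK qs → p ∣K prodK qs → Associate p qs
PrimeK-∣-prodK p-prime All.[]           p∣1 = ⊥-elim (PrimeK⇒∤1 p-prime p∣1)
PrimeK-∣-prodK {p} {q ∷ qs} p-prime (q-prime All.∷ qs-prime) p∣∏ =
  [ here , there ∘ PrimeK-∣-prodK p-prime qs-prime ]′ (PrimeK-∣-* p-prime q (prodK qs) p∣∏)
  where
  here : p ∣K q → Associate p (q ∷ qs)
  here (e , q≡pe) = record { before = [] ; after = qs ; q = q ; e = e ; qs≡ = refl ; q≡pe = q≡pe
                           ; e-unit = PrimeK-associate p-prime q-prime q≡pe }
  there : Associate p qs → Associate p (q ∷ qs)
  there A = record { Associate A ; before = q ∷ Associate.before A ; qs≡ = cong (q ∷_) (Associate.qs≡ A) }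

QRList-primes : ∀ {a ps s} → QRList a ps s → All PrimeK ps
QRList-primes qrl-nil                = All.[]
QRList-primes (qrl-cons p-prime _ L) = p-prime All.∷ QRList-primes L

QRList-middle : ∀ {a} l q r {t} → QRList a (l ++ q ∷ r) t →
                ∃₂ λ s t′ → QRPrime a q s × QRList a (l ++ r) t′ × t ≡ s * t′
QRList-middle []      q r (qrl-cons _ q-symbol L) = _ , _ , q-symbol , L , refl
QRList-middle (p ∷ l) q r (qrl-cons {s = s₀} p-prime p-symbol L) =
  let s , t′ , q-symbol , L′ , t≡st′ = QRList-middle l q r L in
  s , s₀ * t′ , q-symbol , qrl-cons p-prime p-symbol L′ , trans (cong (s₀ *_) t≡st′) (swap s₀ s t′)
  where swap : ∀ a b c → a * (b * c) ≡ b * (a * c)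
        swap = ℤ-Solver.solve-∀

QRPrime-associate : ∀ {a p q e s} → q ≡ p *K e → UnitK e → QRPrime a q s → QRPrime a p s
QRPrime-associate {a} {p} {q} {e} q≡pe (f , ef≡1) = transfer
  where
  q∣⇒p∣ : ∀ {y} → q ∣K y → p ∣K y
  q∣⇒p∣ {y} q∣y = ∣K-trans {p} {q} {y} (e , q≡pe) q∣y
  p∣⇒q∣ : ∀ {y} → p ∣K y → q ∣K y
  p∣⇒q∣ {y} (c , refl) = f *K c , (begin
    p *K c                  ≡⟨ cong (p *K_) (*K-identityˡ c) ⟨
    p *K (1K *K c)          ≡⟨ cong (λ t → p *K (t *K c)) ef≡1 ⟨
    p *K (e *K f *K c)      ≡⟨ cong (p *K_) (*K-assoc e f c) ⟩
    p *K (e *K (f *K c))    ≡⟨ *K-assoc p e (f *K c) ⟨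
    p *K e *K (f *K c)      ≡⟨ cong (_*K (f *K c)) q≡pe ⟨
    q *K (f *K c)           ∎)
    where open ≡-Reasoning
  transfer : ∀ {s} → QRPrime a q s → QRPrime a p s
  transfer (qr-zero q∣a)       = qr-zero (q∣⇒p∣ q∣a)
  transfer (qr-sq q∤a (x , q∣a-x²)) = qr-sq (q∤a ∘ p∣⇒q∣) (x , q∣⇒p∣ q∣a-x²)
  transfer (qr-nsq q∤a ¬□a)    = qr-nsq (q∤a ∘ p∣⇒q∣) (λ (x , p∣a-x²) → ¬□a (x , p∣⇒q∣ p∣a-x²))

-- Unique factorisation, in the form needed: the symbol computed along one
-- factorisation of b can be recomputed along any other.
QRList-transport : ∀ {a} ps qs {u v r} → All PrimeK ps → UnitK u → UnitK v →
                   u *K prodK ps ≡ v *K prodK qs → QRList a qs r → QRList a ps r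
QRList-transport [] [] _ _ _ _ qrl-nil = qrl-nil
QRList-transport [] (q ∷ qs) {u} {v} _ u-unit _ u≡vq∏ (qrl-cons q-prime _ _) =
  ⊥-elim (PrimeK⇒¬UnitK q-prime (∣K-UnitK {q} {u} (v *K prodK qs , (begin
    u                           ≡⟨ *K-identityʳ u ⟨
    u *K 1K                     ≡⟨ u≡vq∏ ⟩
    v *K (q *K prodK qs)        ≡⟨ x∙yz≈y∙xz v q (prodK qs) ⟩
    q *K (v *K prodK qs)        ∎)) u-unit))
  where open ≡-Reasoning
QRList-transport {a} (p ∷ ps) qs {u} {v} (p-prime All.∷ ps-prime) u-unit v-unit u∏≡v∏ L =
  [ ⊥-elim ∘ PrimeK⇒¬UnitK p-prime ∘ (λ p∣v → ∣K-UnitK {p} {v} p∣v v-unit)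
  , step ∘ PrimeK-∣-prodK p-prime (QRList-primes L) ]′
    (PrimeK-∣-* p-prime v (prodK qs) (u *K prodK ps , trans (sym u∏≡v∏) (x∙yz≈y∙xz u p (prodK ps))))
  where
  open ≡-Reasoning
  step : Associate p qs → QRList a (p ∷ ps) _
  step record { before = l ; after = r ; q = q ; e = e ; qs≡ = refl ; q≡pe = q≡pe ; e-unit = e-unit } =
    let s , t′ , q-symbol , L′ , r≡st′ = QRList-middle l q r L in
    subst (QRList a (p ∷ ps)) (sym r≡st′)
      (qrl-cons p-prime (QRPrime-associate q≡pe e-unit q-symbol)
        (QRList-transport ps (l ++ r) {u} {v *K e} ps-prime u-unit (UnitK-* {v} {e} v-unit e-unit)
          (*K-cancelˡ (u *K prodK ps) (v *K e *K prodK (l ++ r)) (PrimeK⇒≢0 p-prime) (begin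
            p *K (u *K prodK ps)             ≡⟨ x∙yz≈y∙xz p u (prodK ps) ⟩
            u *K (p *K prodK ps)             ≡⟨ u∏≡v∏ ⟩
            v *K prodK (l ++ q ∷ r)          ≡⟨ cong (v *K_) (prodK-middle l q r) ⟩
            v *K (q *K prodK (l ++ r))       ≡⟨ cong (λ t → v *K (t *K prodK (l ++ r))) q≡pe ⟩
            v *K (p *K e *K prodK (l ++ r))  ≡⟨ v[pe∏]≡p[ve∏] v p e (prodK (l ++ r)) ⟩
            p *K (v *K e *K prodK (l ++ r))  ∎))
          L′))

QRPrime-cube : ∀ {a p s} → QRPrime a p s → s * s * s ≡ s
QRPrime-cube (qr-zero _)  = refl
QRPrime-cube (qr-sq _ _)  = refl
QRPrime-cube (qr-nsq _ _) = refl

QRList-cube : ∀ {a ps s} → QRList a ps s → s * s * s ≡ s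
QRList-cube qrl-nil = refl
QRList-cube (qrl-cons {s = s} {t} _ p-symbol L) =
  trans (cube-* s t) (cong₂ _*_ (QRPrime-cube p-symbol) (QRList-cube L))
  where cube-* : ∀ s t → s * t * (s * t) * (s * t) ≡ s * s * s * (t * t * t)
        cube-* = ℤ-Solver.solve-∀

QRList-unique : ∀ {a ps s t} → QRList a ps s → QRList a ps t → s ≡ t
QRList-unique qrl-nil qrl-nil = refl
QRList-unique (qrl-cons _ p-symbol L) (qrl-cons _ p-symbol′ L′) =
  cong₂ _*_ (QRPrime-unique p-symbol p-symbol′) (QRList-unique L L′)

QRList-++ : ∀ {a ps qs s t} → QRList a ps s → QRList a qs t → QRList a (ps ++ qs) (s * t)
QRList-++ {a} {qs = qs} {t = t} qrl-nil L = subst (QRList a qs) (sym (ℤ.*-identityˡ t)) L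
QRList-++ {a} {qs = qs} {t = t} (qrl-cons {p} {ps} {s} {s′} p-prime p-symbol L) L′ =
  subst (QRList a (p ∷ ps ++ qs)) (sym (ℤ.*-assoc s s′ t)) (qrl-cons p-prime p-symbol (QRList-++ L L′))

QRList-exists : ∀ {ps} → All PrimeK ps → ∀ a → ∃ λ s → QRList a ps s
QRList-exists All.[]                    a = + 1 , qrl-nil
QRList-exists (p-prime All.∷ ps-prime) a =
  let s , p-symbol = Residues.QRPrime-exists p-prime a
      t , L = QRList-exists ps-prime a
  in s * t , qrl-cons p-prime p-symbol L

OddK : ZK → Set
OddK D = ∃₂ λ X Y → X *K D +K Y *K 2K ≡ 1K

OddK-∣ : ∀ {D p} → OddK D → PrimeK p → p ∣K D → ¬ p ∣K 2K
OddK-∣ {D} {p} (X , Y , XD+Y2≡1) p-prime p∣D p∣2 = PrimeK⇒∤1 p-prime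
  (subst (p ∣K_) XD+Y2≡1 (∣K-+ {p} {X *K D} {Y *K 2K} (∣K-*ˡ {p} {D} X p∣D) (∣K-*ˡ {p} {2K} Y p∣2)))

QRList-* : ∀ {D x y ps s t} → OddK D → prodK ps ∣K D →
           QRList x ps s → QRList y ps t → QRList (x *K y) ps (s * t)
QRList-* _ _ qrl-nil qrl-nil = qrl-nil
QRList-* {D} {x} {y} {p ∷ ps} D-odd ∏∣D
         (qrl-cons {s = s₀} {s′} p-prime p-x L) (qrl-cons {s = t₀} {t′} _ p-y L′) =
  subst (QRList (x *K y) (p ∷ ps)) (interchange-ℤ s₀ t₀ s′ t′)
    (qrl-cons p-prime (Residues.Odd.QRPrime-* p-prime (OddK-∣ D-odd p-prime p∣D) p-x p-y)
      (QRList-* D-odd ∏ps∣D L L′))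
  where
  p∣D : p ∣K D
  p∣D = ∣K-trans {p} {prodK (p ∷ ps)} {D} (prodK ps , refl) ∏∣D
  ∏ps∣D : prodK ps ∣K D
  ∏ps∣D = ∣K-trans {prodK ps} {prodK (p ∷ ps)} {D} (p , *K-comm p (prodK ps)) ∏∣D
  interchange-ℤ : ∀ a b c d → a * b * (c * d) ≡ a * c * (b * d)
  interchange-ℤ = ℤ-Solver.solve-∀

QRSym-onto : ∀ {a b s u ps} → All PrimeK ps → UnitK u → b ≡ u *K prodK ps → QRSym a b s → QRList a ps s
QRSym-onto {u = u} {ps} ps-prime u-unit b≡u∏ (v , qs , v-unit , b≡v∏ , L) =
  QRList-transport ps qs {u} {v} ps-prime u-unit v-unit (trans (sym b≡u∏) b≡v∏) L

QRSym-unique : ∀ {a b s t} → QRSym a b s → QRSym a b t → s ≡ t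
QRSym-unique (u , ps , u-unit , b≡u∏ , L) sym-t =
  QRList-unique L (QRSym-onto {u = u} {ps} (QRList-primes L) u-unit b≡u∏ sym-t)

QRSym-*ʳ : ∀ {a b c s t} → QRSym a b s → QRSym a c t → QRSym a (b *K c) (s * t)
QRSym-*ʳ {b = b} {c} (u , ps , u-unit , b≡u∏ , L) (v , qs , v-unit , c≡v∏ , L′) =
  u *K v , ps ++ qs , UnitK-* {u} {v} u-unit v-unit , bc≡uv∏ , QRList-++ L L′
  where
  bc≡uv∏ : b *K c ≡ u *K v *K prodK (ps ++ qs)
  bc≡uv∏ = trans (cong₂ _*K_ b≡u∏ c≡v∏)
    (trans (interchange u (prodK ps) v (prodK qs)) (cong (u *K v *K_) (sym (prodK-++ ps qs))))

QRSym-*ˡ : ∀ {x y b s t} → OddK b → QRSym x b s → QRSym y b t → QRSym (x *K y) b (s * t)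
QRSym-*ˡ b-odd (u , ps , u-unit , b≡u∏ , L) sym-t =
  u , ps , u-unit , b≡u∏ ,
  QRList-* b-odd (u , trans b≡u∏ (*K-comm u (prodK ps))) L
    (QRSym-onto {u = u} {ps} (QRList-primes L) u-unit b≡u∏ sym-t)

QRSym-exists : ∀ {x b s} → QRSym x b s → ∀ y → ∃ λ t → QRSym y b t
QRSym-exists (u , ps , u-unit , b≡u∏ , L) y =
  let t , L′ = QRList-exists (QRList-primes L) y in t , u , ps , u-unit , b≡u∏ , L′

QRSym-cube : ∀ {a b s} → QRSym a b s → s * s * s ≡ s
QRSym-cube (_ , _ , _ , _ , L) = QRList-cube L

QRSym-cocycle : ∀ {A B C D a b c d} → OddK D → QRSym (A *K (B *K C)) D a → QRSym A D b →
                QRSym (A *K B) D c → QRSym (A *K C) D d → a ≡ b * c * d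
QRSym-cocycle {A} {B} {C} {D} {a} {b} {c} {d} D-odd γ[A,BC] γ[A] γ[A,B] γ[A,C] = begin
  a                          ≡⟨ QRSym-unique γ[A,BC] (QRSym-*ˡ {A} {B *K C} {D} D-odd γ[A] γ[BC]) ⟩
  b * (s * t)                ≡⟨ cong (_* (s * t)) (QRSym-cube γ[A]) ⟨
  b * b * b * (s * t)        ≡⟨ regroup b s t ⟩
  b * (b * s) * (b * t)      ≡⟨ cong₂ (λ u v → b * u * v) c≡bs d≡bt ⟨
  b * c * d                  ∎
  where
  open ≡-Reasoning
  s t : ℤ
  s = proj₁ (QRSym-exists γ[A] B)
  t = proj₁ (QRSym-exists γ[A] C)
  γ[B] : QRSym B D s
  γ[B] = proj₂ (QRSym-exists γ[A] B)
  γ[C] : QRSym C D t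
  γ[C] = proj₂ (QRSym-exists γ[A] C)
  γ[BC] : QRSym (B *K C) D (s * t)
  γ[BC] = QRSym-*ˡ {B} {C} {D} D-odd γ[B] γ[C]
  c≡bs : c ≡ b * s
  c≡bs = QRSym-unique γ[A,B] (QRSym-*ˡ {A} {B} {D} D-odd γ[A] γ[B])
  d≡bt : d ≡ b * t
  d≡bt = QRSym-unique γ[A,C] (QRSym-*ˡ {A} {C} {D} D-odd γ[A] γ[C])
  regroup : ∀ b s t → b * b * b * (s * t) ≡ b * (b * s) * (b * t)
  regroup = ℤ-Solver.solve-∀

-- The relative norm from ℤ[ζ₈] to ℤ[√2]

relNorm : ZM → ZK
relNorm x = toK (x *M τ x)

-- The numerator of γ₂: the relative norm of σ x (note τ ∘ σ = σ ∘ τ).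
relNormσ : ZM → ZK
relNormσ x = toK (σ x *M σ (τ x))

mkM-cong : ∀ {a b c d a′ b′ c′ d′} → a ≡ a′ → b ≡ b′ → c ≡ c′ → d ≡ d′ → mkM a b c d ≡ mkM a′ b′ c′ d′
mkM-cong refl refl refl refl = refl

σ-* : ∀ x y → σ (x *M y) ≡ σ x *M σ y
σ-* (mkM a b c d) (mkM e f g h) =
  mkM-cong (c₀ a b c d e f g h) (c₁ a b c d e f g h) (c₂ a b c d e f g h) (c₃ a b c d e f g h)
  where
  c₀ : ∀ a b c d e f g h → a * e - b * h - c * g - d * f ≡ a * e - - b * - h - c * g - - d * - f
  c₀ = ℤ-Solver.solve-∀
  c₁ : ∀ a b c d e f g h → - (a * f + b * e - c * h - d * g) ≡ a * - f + - b * e - c * - h - - d * g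
  c₁ = ℤ-Solver.solve-∀
  c₂ : ∀ a b c d e f g h → a * g + b * f + c * e - d * h ≡ a * g + - b * - f + c * e - - d * - h
  c₂ = ℤ-Solver.solve-∀
  c₃ : ∀ a b c d e f g h → - (a * h + b * g + c * f + d * e) ≡ a * - h + - b * g + c * - f + - d * e
  c₃ = ℤ-Solver.solve-∀

-- In the let-blocks, mᵢ are the coordinates of a product in ℤ[ζ₈] and nᵢ
-- those of the relative norm x τ(x), exactly as _*M_, τ and toK compute them.
relNorm-* : ∀ x y → relNorm (x *M y) ≡ relNorm x *K relNorm y
relNorm-* (mkM a b c d) (mkM e f g h) = cong₂ mkK (re a b c d e f g h) (im a b c d e f g h)
  where
  re : ∀ a b c d e f g h →
    let m₀ x₀ x₁ x₂ x₃ y₀ y₁ y₂ y₃ = x₀ * y₀ - x₁ * y₃ - x₂ * y₂ - x₃ * y₁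
        m₁ x₀ x₁ x₂ x₃ y₀ y₁ y₂ y₃ = x₀ * y₁ + x₁ * y₀ - x₂ * y₃ - x₃ * y₂
        m₂ x₀ x₁ x₂ x₃ y₀ y₁ y₂ y₃ = x₀ * y₂ + x₁ * y₁ + x₂ * y₀ - x₃ * y₃
        m₃ x₀ x₁ x₂ x₃ y₀ y₁ y₂ y₃ = x₀ * y₃ + x₁ * y₂ + x₂ * y₁ + x₃ * y₀
        n₀ x₀ x₁ x₂ x₃ = m₀ x₀ x₁ x₂ x₃ x₀ (- x₃) (- x₂) (- x₁)
        n₁ x₀ x₁ x₂ x₃ = m₁ x₀ x₁ x₂ x₃ x₀ (- x₃) (- x₂) (- x₁)
    in  n₀ (m₀ a b c d e f g h) (m₁ a b c d e f g h) (m₂ a b c d e f g h) (m₃ a b c d e f g h)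
        ≡ n₀ a b c d * n₀ e f g h + + 2 * (n₁ a b c d * n₁ e f g h)
  re = ℤ-Solver.solve-∀
  im : ∀ a b c d e f g h →
    let m₀ x₀ x₁ x₂ x₃ y₀ y₁ y₂ y₃ = x₀ * y₀ - x₁ * y₃ - x₂ * y₂ - x₃ * y₁
        m₁ x₀ x₁ x₂ x₃ y₀ y₁ y₂ y₃ = x₀ * y₁ + x₁ * y₀ - x₂ * y₃ - x₃ * y₂
        m₂ x₀ x₁ x₂ x₃ y₀ y₁ y₂ y₃ = x₀ * y₂ + x₁ * y₁ + x₂ * y₀ - x₃ * y₃
        m₃ x₀ x₁ x₂ x₃ y₀ y₁ y₂ y₃ = x₀ * y₃ + x₁ * y₂ + x₂ * y₁ + x₃ * y₀
        n₀ x₀ x₁ x₂ x₃ = m₀ x₀ x₁ x₂ x₃ x₀ (- x₃) (- x₂) (- x₁)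
        n₁ x₀ x₁ x₂ x₃ = m₁ x₀ x₁ x₂ x₃ x₀ (- x₃) (- x₂) (- x₁)
    in  n₁ (m₀ a b c d e f g h) (m₁ a b c d e f g h) (m₂ a b c d e f g h) (m₃ a b c d e f g h)
        ≡ n₀ a b c d * n₁ e f g h + n₁ a b c d * n₀ e f g h
  im = ℤ-Solver.solve-∀

relNormσ-* : ∀ x y → relNormσ (x *M y) ≡ relNormσ x *K relNormσ y
relNormσ-* x y = trans (cong relNorm (σ-* x y)) (relNorm-* (σ x) (σ y))

-- Here sᵢ are the coordinates of 2y and tᵢ those of y τ(u) + u τ(y) + 2 y τ(y).
relNorm-+2* : ∀ u y → relNorm (u +M y *M 2M) ≡
              relNorm u +K toK (y *M τ u +M u *M τ y +M 2M *M (y *M τ y)) *K 2K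
relNorm-+2* (mkM a b c d) (mkM e f g h) = cong₂ mkK (re a b c d e f g h) (im a b c d e f g h)
  where
  re : ∀ a b c d e f g h →
    let m₀ x₀ x₁ x₂ x₃ y₀ y₁ y₂ y₃ = x₀ * y₀ - x₁ * y₃ - x₂ * y₂ - x₃ * y₁
        m₁ x₀ x₁ x₂ x₃ y₀ y₁ y₂ y₃ = x₀ * y₁ + x₁ * y₀ - x₂ * y₃ - x₃ * y₂
        m₂ x₀ x₁ x₂ x₃ y₀ y₁ y₂ y₃ = x₀ * y₂ + x₁ * y₁ + x₂ * y₀ - x₃ * y₃
        m₃ x₀ x₁ x₂ x₃ y₀ y₁ y₂ y₃ = x₀ * y₃ + x₁ * y₂ + x₂ * y₁ + x₃ * y₀
        n₀ x₀ x₁ x₂ x₃ = m₀ x₀ x₁ x₂ x₃ x₀ (- x₃) (- x₂) (- x₁)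
        n₁ x₀ x₁ x₂ x₃ = m₁ x₀ x₁ x₂ x₃ x₀ (- x₃) (- x₂) (- x₁)
        n₂ x₀ x₁ x₂ x₃ = m₂ x₀ x₁ x₂ x₃ x₀ (- x₃) (- x₂) (- x₁)
        n₃ x₀ x₁ x₂ x₃ = m₃ x₀ x₁ x₂ x₃ x₀ (- x₃) (- x₂) (- x₁)
        s₀ = m₀ e f g h (+ 2) (+ 0) (+ 0) (+ 0)
        s₁ = m₁ e f g h (+ 2) (+ 0) (+ 0) (+ 0)
        s₂ = m₂ e f g h (+ 2) (+ 0) (+ 0) (+ 0)
        s₃ = m₃ e f g h (+ 2) (+ 0) (+ 0) (+ 0)
        t₀ = m₀ e f g h a (- d) (- c) (- b) + m₀ a b c d e (- h) (- g) (- f)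
             + m₀ (+ 2) (+ 0) (+ 0) (+ 0) (n₀ e f g h) (n₁ e f g h) (n₂ e f g h) (n₃ e f g h)
        t₁ = m₁ e f g h a (- d) (- c) (- b) + m₁ a b c d e (- h) (- g) (- f)
             + m₁ (+ 2) (+ 0) (+ 0) (+ 0) (n₀ e f g h) (n₁ e f g h) (n₂ e f g h) (n₃ e f g h)
    in  n₀ (a + s₀) (b + s₁) (c + s₂) (d + s₃) ≡ n₀ a b c d + (t₀ * + 2 + + 2 * (t₁ * + 0))
  re = ℤ-Solver.solve-∀
  im : ∀ a b c d e f g h →
    let m₀ x₀ x₁ x₂ x₃ y₀ y₁ y₂ y₃ = x₀ * y₀ - x₁ * y₃ - x₂ * y₂ - x₃ * y₁
        m₁ x₀ x₁ x₂ x₃ y₀ y₁ y₂ y₃ = x₀ * y₁ + x₁ * y₀ - x₂ * y₃ - x₃ * y₂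
        m₂ x₀ x₁ x₂ x₃ y₀ y₁ y₂ y₃ = x₀ * y₂ + x₁ * y₁ + x₂ * y₀ - x₃ * y₃
        m₃ x₀ x₁ x₂ x₃ y₀ y₁ y₂ y₃ = x₀ * y₃ + x₁ * y₂ + x₂ * y₁ + x₃ * y₀
        n₀ x₀ x₁ x₂ x₃ = m₀ x₀ x₁ x₂ x₃ x₀ (- x₃) (- x₂) (- x₁)
        n₁ x₀ x₁ x₂ x₃ = m₁ x₀ x₁ x₂ x₃ x₀ (- x₃) (- x₂) (- x₁)
        n₂ x₀ x₁ x₂ x₃ = m₂ x₀ x₁ x₂ x₃ x₀ (- x₃) (- x₂) (- x₁)
        n₃ x₀ x₁ x₂ x₃ = m₃ x₀ x₁ x₂ x₃ x₀ (- x₃) (- x₂) (- x₁)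
        s₀ = m₀ e f g h (+ 2) (+ 0) (+ 0) (+ 0)
        s₁ = m₁ e f g h (+ 2) (+ 0) (+ 0) (+ 0)
        s₂ = m₂ e f g h (+ 2) (+ 0) (+ 0) (+ 0)
        s₃ = m₃ e f g h (+ 2) (+ 0) (+ 0) (+ 0)
        t₀ = m₀ e f g h a (- d) (- c) (- b) + m₀ a b c d e (- h) (- g) (- f)
             + m₀ (+ 2) (+ 0) (+ 0) (+ 0) (n₀ e f g h) (n₁ e f g h) (n₂ e f g h) (n₃ e f g h)
        t₁ = m₁ e f g h a (- d) (- c) (- b) + m₁ a b c d e (- h) (- g) (- f)
             + m₁ (+ 2) (+ 0) (+ 0) (+ 0) (n₀ e f g h) (n₁ e f g h) (n₂ e f g h) (n₃ e f g h)
    in  n₁ (a + s₀) (b + s₁) (c + s₂) (d + s₃) ≡ n₁ a b c d + (t₀ * + 0 + t₁ * + 2)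
  im = ℤ-Solver.solve-∀

relNormσ-*1 : ∀ x → relNormσ (x *M 1M) ≡ relNormσ x
relNormσ-*1 x = trans (relNormσ-* x 1M) (*K-identityʳ (relNormσ x))

relNormσ-comm : ∀ x y → relNormσ (x *M y) ≡ relNormσ (y *M x)
relNormσ-comm x y = begin
  relNormσ (x *M y)               ≡⟨ relNormσ-* x y ⟩
  relNormσ x *K relNormσ y        ≡⟨ *K-comm (relNormσ x) (relNormσ y) ⟩
  relNormσ y *K relNormσ x        ≡⟨ relNormσ-* y x ⟨
  relNormσ (y *M x)               ∎
  where open ≡-Reasoning

-- Applying the relative norm to x w + 2 y = 1.
OddM⇒OddK : ∀ {w} → OddM w → OddK (relNorm w)
OddM⇒OddK {w} (x , y , xw+2y≡1) = relNorm x , Y , (begin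
  relNorm x *K relNorm w +K Y *K 2K    ≡⟨ cong (_+K Y *K 2K) (relNorm-* x w) ⟨
  relNorm (x *M w) +K Y *K 2K          ≡⟨ relNorm-+2* (x *M w) y ⟨
  relNorm (x *M w +M y *M 2M)          ≡⟨ cong relNorm xw+2y≡1 ⟩
  1K                                   ∎)
  where
  open ≡-Reasoning
  Y = toK (y *M τ (x *M w) +M (x *M w) *M τ y +M 2M *M (y *M τ y))

Gamma2-swap : ∀ w z (a b c : ℤ) → Gamma2 w z a → Gamma2 z w b → Mfun (w *M z) c → a * b ≡ c
Gamma2-swap w z a b c γ[w,z] γ[z,w] m[wz] = QRSym-unique (QRSym-*ʳ γ[w,z] γ[z,w]′) m[wz]′
  where
  γ[z,w]′ : QRSym (relNormσ (w *M z)) (relNorm z) b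
  γ[z,w]′ = subst (λ A → QRSym A (relNorm z) b) (relNormσ-comm z w) γ[z,w]
  m[wz]′ : QRSym (relNormσ (w *M z)) (relNorm w *K relNorm z) c
  m[wz]′ = subst₂ (λ A B → QRSym A B c) (relNormσ-*1 (w *M z)) (relNorm-* w z) m[wz]

Gamma2-* : ∀ w z₁ z₂ → OddM w → (a b c d : ℤ) → Gamma2 w (z₁ *M z₂) a → Mfun w b →
           Gamma2 w z₁ c → Gamma2 w z₂ d → a ≡ b * c * d
Gamma2-* w z₁ z₂ w-odd a b c d γ[w,z₁z₂] m[w] γ[w,z₁] γ[w,z₂] =
  QRSym-cocycle (OddM⇒OddK w-odd)
    (numerator (z₁ *M z₂) a N[wz₁z₂] γ[w,z₁z₂]) (numerator 1M b (relNormσ-*1 w) m[w])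
    (numerator z₁ c (relNormσ-* w z₁) γ[w,z₁]) (numerator z₂ d (relNormσ-* w z₂) γ[w,z₂])
  where
  numerator : ∀ z s {A} → relNormσ (w *M z) ≡ A → Gamma2 w z s → QRSym A (relNorm w) s
  numerator z s eq = subst (λ A → QRSym A (relNorm w) s) eq
  N[wz₁z₂] : relNormσ (w *M (z₁ *M z₂)) ≡ relNormσ w *K (relNormσ z₁ *K relNormσ z₂)
  N[wz₁z₂] = trans (relNormσ-* w (z₁ *M z₂)) (cong (relNormσ w *K_) (relNormσ-* z₁ z₂))

lemma6p4 : (w z z₁ z₂ : ZM) → OddM w → OddM z → OddM z₁ → OddM z₂ →
    ((a b c : ℤ) → Gamma2 w z a → Gamma2 z w b → Mfun (w *M z) c →
       a * b ≡ c)
    × ((a b c d : ℤ) → Gamma2 w (z₁ *M z₂) a → Mfun w b →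
       Gamma2 w z₁ c → Gamma2 w z₂ d → a ≡ b * c * d)
lemma6p4 w z z₁ z₂ w-odd _ _ _ = Gamma2-swap w z , Gamma2-* w z₁ z₂ w-odd
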